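{- Let $K$ be any primary pseudoperfect number divisible by $6$. Then $K \equiv 6 \pmod{36}$.
   Context: A primary pseudoperfect number is an integer $K>1$ satisfying $\frac{1}{K} + \sum_{p \mid K} \frac{1}{p} = 1$, where the sum runs over the distinct primes $p$ dividing $K$. -}

module Defs where

open import Data.Nat using (ℕ; zero; suc; _<_)
open import Data.Nat.Divisibility using (_∣_; _∣?_)
open import Data.Nat.Primality using (Prime; prime?)
open import Data.List using (List; filter; upTo; foldr)
open import Data.Integer using (+_)
open import Data.Rational using (ℚ; 0ℚ; 1ℚ; _/_; _+_)
open import Relation.Nullary.Decidable using (_×-dec_)
open import Relation.Binary.PropositionalEquality using (_≡_)
open import Data.Product using (_×_)

-- reciprocal 1/n as a rational (the n = 0 case is never used: only primes are inverted)
inv : ℕ → ℚ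
inv zero    = 0ℚ
inv (suc n) = + 1 / suc n

primeDivisors : ℕ → List ℕ
primeDivisors K = filter (λ p → prime? p ×-dec p ∣? K) (upTo (suc K))

sumInvPrimeDivisors : ℕ → ℚ
sumInvPrimeDivisors K = foldr (λ p acc → inv p + acc) 0ℚ (primeDivisors K)

PrimaryPseudoperfect : ℕ → Set
PrimaryPseudoperfect K = (1 < K) × (inv K + sumInvPrimeDivisors K ≡ 1ℚ)

module Submission where

-- Idea.  Multiplying  1/K + Σ_{p ∣ K} 1/p = 1  by K gives the integer identity
--
--     1 + Σ_{p ∣ K} K/p = K .
--
-- For a prime q ∣ K every cofactor K/p with p ≠ q is still divisible by q, so
-- reducing the identity modulo q leaves  K ≡ 1 + K/q (mod q).  Writing K = 6m,
-- the case q = 3 gives 6m ≡ 1 + 2m (mod 3) and the case q = 2 gives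
-- 6m ≡ 1 + 3m (mod 2); together they force m ≡ 1 (mod 6), i.e. K ≡ 6 (mod 36).

open import Defs
open import Data.Nat using (ℕ; _%_)
open import Data.Nat.Divisibility using (_∣_)
open import Relation.Binary.PropositionalEquality using (_≡_)

open import Data.Nat using (zero; suc; _+_; _*_; _/_; _<_; s≤s; NonZero)
open import Data.Nat.Properties using (*-identityˡ; *-identityʳ; *-assoc)
open import Data.Nat.Divisibility
  using (divides; _∣?_; ∣-trans; ∣-reflexive; ∣m∣n⇒∣m+n; 0∣⇒≡0; ∣⇒≤)
open import Data.Nat.DivMod using (m/n*n≡m; m*n/n≡m; [m+kn]%n≡m%n; m≡m%n+[m/n]*n; m%n<n)
open import Data.Nat.Primality using (Prime; prime?; euclidsLemma; prime⇒irreducible; ¬prime[0]; ¬prime[1])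
open import Data.Nat.Tactic.RingSolver using (solve-∀)
import Data.Integer.Tactic.RingSolver as ℤ-Solver
open import Data.Integer as ℤ using (+_)
open import Data.Integer.Properties using (pos-*; pos-+; +-injective)
open import Data.Rational as ℚ using (0ℚ; toℚᵘ)
open import Data.Rational.Properties using (toℚᵘ-fromℚᵘ; toℚᵘ-homo-+; toℚᵘ-cong)
open import Data.Rational.Unnormalised as ℚᵘ using (mkℚᵘ; *≡*; _≃_)
open import Data.Rational.Unnormalised.Properties using (≃-trans; +-cong; module ≃-Reasoning)
open import Data.List using (List; []; _∷_; foldr; upTo; map)
open import Data.Nat.ListAction using (sum)
open import Data.List.Relation.Unary.All as All using (All; []; _∷_)
open import Data.List.Relation.Unary.All.Properties using (all-filter)
open import Data.List.Relation.Unary.Unique.Propositional using (Unique)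
open import Data.List.Relation.Unary.Unique.Propositional.Properties using (upTo⁺)
  renaming (filter⁺ to unique-filter⁺)
open import Data.List.Relation.Unary.AllPairs using (_∷_)
open import Data.List.Membership.Propositional using (_∈_)
open import Data.List.Membership.Propositional.Properties using (∈-filter⁺; ∈-upTo⁺)
open import Data.List.Relation.Unary.Any using (here; there)
open import Data.Product using (_×_; _,_; ∃; proj₁; proj₂)
open import Data.Sum using (inj₁; inj₂)
open import Data.Empty using (⊥-elim)
open import Relation.Nullary.Decidable using (_×-dec_; from-yes)
open import Relation.Binary.PropositionalEquality using (refl; sym; trans; cong; cong₂; _≢_; ≢-sym; module ≡-Reasoning)

-- The cofactor K / p of a divisor p of K (the value at p = 0 is irrelevant:
-- 0 never divides a positive K).
cofactor : ℕ → ℕ → ℕ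
cofactor K zero    = 0
cofactor K (suc p) = K / suc p

cofactorSum : ℕ → List ℕ → ℕ
cofactorSum K l = sum (map (cofactor K) l)

PrimeDivisorOf : ℕ → ℕ → Set
PrimeDivisorOf K p = Prime p × p ∣ K

cofactor-of-product : ∀ a q → cofactor (a * suc q) (suc q) ≡ a
cofactor-of-product a q = m*n/n≡m a (suc q)

primeDivisors-sound : ∀ K → All (PrimeDivisorOf K) (primeDivisors K)
primeDivisors-sound K = all-filter (λ p → prime? p ×-dec p ∣? K) (upTo (suc K))

primeDivisors-unique : ∀ K → Unique (primeDivisors K)
primeDivisors-unique K = unique-filter⁺ (λ p → prime? p ×-dec p ∣? K) (upTo⁺ (suc K))

primeDivisors-complete : ∀ K {q} .{{_ : NonZero K}} → PrimeDivisorOf K q → q ∈ primeDivisors K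
primeDivisors-complete K q∣K@(_ , q∣K′) =
  ∈-filter⁺ (λ p → prime? p ×-dec p ∣? K) (∈-upTo⁺ (s≤s (∣⇒≤ q∣K′))) q∣K

+-commonDenominator : ∀ a b k →
  (+ a ℚᵘ./ suc k) ℚᵘ.+ (+ b ℚᵘ./ suc k) ≃ + (a + b) ℚᵘ./ suc k
+-commonDenominator a b k = *≡* (begin
  (+ a ℤ.* + K ℤ.+ + b ℤ.* + K) ℤ.* + K ≡⟨ distribute (+ a) (+ b) (+ K) ⟩
  (+ a ℤ.+ + b) ℤ.* (+ K ℤ.* + K)       ≡⟨ sym (cong₂ ℤ._*_ (pos-+ a b) (pos-* K K)) ⟩
  + (a + b) ℤ.* + (K * K)               ∎)
  where
  open ≡-Reasoning
  K = suc k
  distribute : ∀ x y z → (x ℤ.* z ℤ.+ y ℤ.* z) ℤ.* z ≡ (x ℤ.+ y) ℤ.* (z ℤ.* z)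
  distribute = ℤ-Solver.solve-∀

inv≃unitFraction : ∀ k → toℚᵘ (inv (suc k)) ≃ + 1 ℚᵘ./ suc k
inv≃unitFraction k = toℚᵘ-fromℚᵘ (mkℚᵘ (+ 1) k)

unitFraction≃cofactor : ∀ k p → p ∣ suc k → toℚᵘ (inv p) ≃ + cofactor (suc k) p ℚᵘ./ suc k
unitFraction≃cofactor k zero    0∣K with () ← 0∣⇒≡0 0∣K
unitFraction≃cofactor k (suc q) p∣K = ≃-trans (inv≃unitFraction q) (*≡* (begin
  + 1 ℤ.* + suc k                    ≡⟨ cong +_ (*-identityˡ (suc k)) ⟩
  + suc k                            ≡⟨ cong +_ (sym (m/n*n≡m p∣K)) ⟩
  + (suc k / suc q * suc q)          ≡⟨ pos-* (suc k / suc q) (suc q) ⟩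
  + (suc k / suc q) ℤ.* + suc q      ∎))
  where open ≡-Reasoning

reciprocalSum≃cofactorSum : ∀ k l → All (_∣ suc k) l →
  toℚᵘ (foldr (λ p acc → inv p ℚ.+ acc) 0ℚ l) ≃ + cofactorSum (suc k) l ℚᵘ./ suc k
reciprocalSum≃cofactorSum k []      []           = *≡* refl
reciprocalSum≃cofactorSum k (p ∷ l) (p∣K ∷ l∣K) =
  ≃-trans (toℚᵘ-homo-+ (inv p) _)
  (≃-trans (+-cong (unitFraction≃cofactor k p p∣K) (reciprocalSum≃cofactorSum k l l∣K))
           (+-commonDenominator (cofactor (suc k) p) (cofactorSum (suc k) l) k))

fraction≃1⇒≡ : ∀ n k → + n ℚᵘ./ suc k ≃ + 1 ℚᵘ./ 1 → n ≡ suc k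
fraction≃1⇒≡ n k (*≡* cross-mult) = begin
  n               ≡⟨ sym (*-identityʳ n) ⟩
  n * 1           ≡⟨ +-injective (begin
                       + (n * 1)           ≡⟨ pos-* n 1 ⟩
                       + n ℤ.* + 1         ≡⟨ cross-mult ⟩
                       + 1 ℤ.* + suc k     ≡⟨ sym (pos-* 1 (suc k)) ⟩
                       + (1 * suc k)       ∎) ⟩
  1 * suc k       ≡⟨ *-identityˡ (suc k) ⟩
  suc k           ∎
  where open ≡-Reasoning

pseudoperfect⇒cofactorIdentity : ∀ K → PrimaryPseudoperfect K →
  1 + cofactorSum K (primeDivisors K) ≡ K
pseudoperfect⇒cofactorIdentity zero    (() , _)
pseudoperfect⇒cofactorIdentity (suc k) (_ , defining-eq) = fraction≃1⇒≡ (1 + S) k (begin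
  + (1 + S) ℚᵘ./ K                                 ≈⟨ +-commonDenominator 1 S k ⟨
  (+ 1 ℚᵘ./ K) ℚᵘ.+ (+ S ℚᵘ./ K)                   ≈⟨ +-cong (inv≃unitFraction k) reciprocals ⟨
  toℚᵘ (inv K) ℚᵘ.+ toℚᵘ (sumInvPrimeDivisors K)   ≈⟨ toℚᵘ-homo-+ (inv K) _ ⟨
  toℚᵘ (inv K ℚ.+ sumInvPrimeDivisors K)           ≈⟨ toℚᵘ-cong defining-eq ⟩
  + 1 ℚᵘ./ 1                                       ∎)
  where
  open ≃-Reasoning
  K = suc k
  S = cofactorSum K (primeDivisors K)
  reciprocals : toℚᵘ (sumInvPrimeDivisors K) ≃ + S ℚᵘ./ K
  reciprocals = reciprocalSum≃cofactorSum k (primeDivisors K) (All.map proj₂ (primeDivisors-sound K))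

-- If q and p ≠ q are prime divisors of K, then q divides K/p:
-- q ∣ (K/p)·p and q cannot divide the prime p.
prime∣cofactor : ∀ {K q p} → PrimeDivisorOf K q → PrimeDivisorOf K p → q ≢ p → q ∣ cofactor K p
prime∣cofactor {K} {q} {zero}  _ (p-prime , _) _ = ⊥-elim (¬prime[0] p-prime)
prime∣cofactor {K} {q} {suc p} (q-prime , q∣K) (p-prime , p∣K) q≢p
  with euclidsLemma (K / suc p) (suc p) q-prime (∣-trans q∣K (∣-reflexive (sym (m/n*n≡m p∣K))))
... | inj₁ q∣cofactor = q∣cofactor
... | inj₂ q∣p with prime⇒irreducible p-prime q∣p
...   | inj₁ refl = ⊥-elim (¬prime[1] q-prime)
...   | inj₂ q≡p  = ⊥-elim (q≢p q≡p)

prime∣cofactorSum : ∀ {K q} l → PrimeDivisorOf K q → All (PrimeDivisorOf K) l → All (q ≢_) l →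
  q ∣ cofactorSum K l
prime∣cofactorSum []      _ []         []           = divides 0 refl
prime∣cofactorSum (p ∷ l) q∣K (p∣K ∷ ps) (q≢p ∷ q≢ps) =
  ∣m∣n⇒∣m+n (prime∣cofactor q∣K p∣K q≢p) (prime∣cofactorSum l q∣K ps q≢ps)

cofactorSum≡cofactor-mod : ∀ {K q} l → PrimeDivisorOf K q → Unique l → All (PrimeDivisorOf K) l →
  q ∈ l → ∃ λ t → cofactorSum K l ≡ cofactor K q + t * q
cofactorSum≡cofactor-mod {K} {q} (.q ∷ l) q∣K (q∉l ∷ _) (_ ∷ ps) (here refl)
  with prime∣cofactorSum l q∣K ps q∉l
... | divides t rest≡tq = t , cong (λ rest → cofactor K q + rest) rest≡tq
cofactorSum≡cofactor-mod {K} {q} (p ∷ l) q∣K (p∉l ∷ unique) (p∣K ∷ ps) (there q∈l)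
  with cofactorSum≡cofactor-mod l q∣K unique ps q∈l
     | prime∣cofactor q∣K p∣K (≢-sym (All.lookup p∉l q∈l))
... | t , rest≡ | divides s head≡sq = s + t , (begin
  cofactor K p + cofactorSum K l     ≡⟨ cong₂ _+_ head≡sq rest≡ ⟩
  s * q + (cofactor K q + t * q)     ≡⟨ collect s t (cofactor K q) q ⟩
  cofactor K q + (s + t) * q         ∎)
  where
  open ≡-Reasoning
  collect : ∀ s t c q → s * q + (c + t * q) ≡ c + (s + t) * q
  collect = solve-∀

pseudoperfect-congruence : ∀ K a q → PrimaryPseudoperfect K → Prime q → K ≡ a * q →
  ∃ λ t → K ≡ 1 + (a + t * q)
pseudoperfect-congruence zero    a q       (() , _) _ _
pseudoperfect-congruence K       a zero    _ q-prime _ = ⊥-elim (¬prime[0] q-prime)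
pseudoperfect-congruence (suc k) a (suc q) pp q-prime K≡aq
  with cofactorSum≡cofactor-mod (primeDivisors (suc k)) q∣K (primeDivisors-unique (suc k))
         (primeDivisors-sound (suc k)) (primeDivisors-complete (suc k) q∣K)
  where
  q∣K : PrimeDivisorOf (suc k) (suc q)
  q∣K = q-prime , divides a K≡aq
... | t , sum≡ = t , (begin
  suc k                                           ≡⟨ sym (pseudoperfect⇒cofactorIdentity (suc k) pp) ⟩
  1 + cofactorSum (suc k) (primeDivisors (suc k)) ≡⟨ cong (λ n → 1 + n) sum≡ ⟩
  1 + (cofactor (suc k) (suc q) + t * suc q)      ≡⟨ cong (λ c → 1 + (c + t * suc q)) cofactor≡a ⟩
  1 + (a + t * suc q)                             ∎)
  where
  open ≡-Reasoning
  cofactor≡a : cofactor (suc k) (suc q) ≡ a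
  cofactor≡a = trans (cong (λ K → cofactor K (suc q)) K≡aq) (cofactor-of-product a q)

%-cong-multiples : ∀ n .{{_ : NonZero n}} x y k l → x + k * n ≡ y + l * n → x % n ≡ y % n
%-cong-multiples n x y k l eq = begin
  x % n           ≡⟨ sym ([m+kn]%n≡m%n x k n) ⟩
  (x + k * n) % n ≡⟨ cong (_% n) eq ⟩
  (y + l * n) % n ≡⟨ [m+kn]%n≡m%n y l n ⟩
  y % n           ∎
  where open ≡-Reasoning

residue-check : ∀ r → r < 6 → (r * 6) % 3 ≡ (1 + r * 2) % 3 → (r * 6) % 2 ≡ (1 + r * 3) % 2 → r ≡ 1
residue-check 0 _ () _
residue-check 1 _ _  _ = refl
residue-check 2 _ () _
residue-check 3 _ () _
residue-check 4 _ _  ()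
residue-check 5 _ () _
residue-check (suc (suc (suc (suc (suc (suc _)))))) (s≤s (s≤s (s≤s (s≤s (s≤s (s≤s ())))))) _ _

-- If 6m ≡ 1 + 2m (mod 3) and 6m ≡ 1 + 3m (mod 2), then m ≡ 1 (mod 6):
-- both congruences only depend on m modulo 6.
residue-mod6 : ∀ m a b → m * 6 ≡ 1 + (m * 2 + a * 3) → m * 6 ≡ 1 + (m * 3 + b * 2) → m % 6 ≡ 1
residue-mod6 m a b mod3 mod2 = residue-check r (m%n<n m 6) mod3′ mod2′
  where
  open ≡-Reasoning
  r = m % 6
  q = m / 6
  m≡r+6q : m ≡ r + q * 6
  m≡r+6q = m≡m%n+[m/n]*n m 6
  expand : ∀ r q → r * 6 + q * 36 ≡ (r + q * 6) * 6
  expand = solve-∀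
  regroup3 : ∀ r q a → 1 + ((r + q * 6) * 2 + a * 3) ≡ 1 + r * 2 + (q * 4 + a) * 3
  regroup3 = solve-∀
  regroup2 : ∀ r q b → 1 + ((r + q * 6) * 3 + b * 2) ≡ 1 + r * 3 + (q * 9 + b) * 2
  regroup2 = solve-∀
  mod3′ : (r * 6) % 3 ≡ (1 + r * 2) % 3
  mod3′ = %-cong-multiples 3 _ _ (q * 12) (q * 4 + a) (begin
    r * 6 + q * 12 * 3                       ≡⟨ cong (λ n → r * 6 + n) (*-assoc q 12 3) ⟩
    r * 6 + q * 36                           ≡⟨ expand r q ⟩
    (r + q * 6) * 6                          ≡⟨ cong (_* 6) (sym m≡r+6q) ⟩
    m * 6                                    ≡⟨ mod3 ⟩
    1 + (m * 2 + a * 3)                      ≡⟨ cong (λ x → 1 + (x * 2 + a * 3)) m≡r+6q ⟩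
    1 + ((r + q * 6) * 2 + a * 3)            ≡⟨ regroup3 r q a ⟩
    1 + r * 2 + (q * 4 + a) * 3              ∎)
  mod2′ : (r * 6) % 2 ≡ (1 + r * 3) % 2
  mod2′ = %-cong-multiples 2 _ _ (q * 18) (q * 9 + b) (begin
    r * 6 + q * 18 * 2                       ≡⟨ cong (λ n → r * 6 + n) (*-assoc q 18 2) ⟩
    r * 6 + q * 36                           ≡⟨ expand r q ⟩
    (r + q * 6) * 6                          ≡⟨ cong (_* 6) (sym m≡r+6q) ⟩
    m * 6                                    ≡⟨ mod2 ⟩
    1 + (m * 3 + b * 2)                      ≡⟨ cong (λ x → 1 + (x * 3 + b * 2)) m≡r+6q ⟩
    1 + ((r + q * 6) * 3 + b * 2)            ≡⟨ regroup2 r q b ⟩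
    1 + r * 3 + (q * 9 + b) * 2              ∎)

sixfold-mod36 : ∀ m → m % 6 ≡ 1 → (m * 6) % 36 ≡ 6
sixfold-mod36 m m%6≡1 = begin
  (m * 6) % 36                   ≡⟨ cong (λ x → (x * 6) % 36) (m≡m%n+[m/n]*n m 6) ⟩
  ((m % 6 + m / 6 * 6) * 6) % 36 ≡⟨ cong (λ x → ((x + m / 6 * 6) * 6) % 36) m%6≡1 ⟩
  ((1 + m / 6 * 6) * 6) % 36     ≡⟨ cong (_% 36) (expand (m / 6)) ⟩
  (6 + m / 6 * 36) % 36          ≡⟨ [m+kn]%n≡m%n 6 (m / 6) 36 ⟩
  6                              ∎
  where
  open ≡-Reasoning
  expand : ∀ q → (1 + q * 6) * 6 ≡ 6 + q * 36
  expand = solve-∀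

proposition2 : (K : ℕ) → PrimaryPseudoperfect K → 6 ∣ K → K % 36 ≡ 6
proposition2 _ pp (divides m refl) =
  sixfold-mod36 m (residue-mod6 m (proj₁ mod3) (proj₁ mod2) (proj₂ mod3) (proj₂ mod2))
  where
  mod3 : ∃ λ t → m * 6 ≡ 1 + (m * 2 + t * 3)
  mod3 = pseudoperfect-congruence (m * 6) (m * 2) 3 pp (from-yes (prime? 3)) (sym (*-assoc m 2 3))
  mod2 : ∃ λ t → m * 6 ≡ 1 + (m * 3 + t * 2)
  mod2 = pseudoperfect-congruence (m * 6) (m * 3) 2 pp (from-yes (prime? 2)) (sym (*-assoc m 3 2))
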